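{- For every positive integer $n$, every $\pi\in S_n$ and every integer $k$, $T^{ -k}(\pi)=\operatorname{rev}\bigl(T^{k}(\operatorname{rev}(\pi))\bigr)$.
   Context: Permutations $\pi\in S_n$ are written in one-line notation $\pi=\pi_1\pi_2\cdots\pi_n$, and $\operatorname{rev}(\pi)=\pi_n\pi_{n-1}\cdots\pi_1$. The topdrop map $T:S_n\to S_n$ is defined by $T(\pi_1\cdots\pi_n)=\pi_{\pi_1+1}\cdots\pi_n\,\pi_{\pi_1}\pi_{\pi_1-1}\cdots\pi_1$ (the first $\pi_1$ entries are removed, reversed and appended at the end). $T$ is a bijection; $T^k$ denotes the $k$-fold composition of $T$ for $k\ge0$ and $T^{ -k}$ the $k$-fold composition of $T^{ -1}$. -}

module Defs where

open import Data.Nat using (ℕ; zero; suc; _∸_)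
open import Data.Integer using (ℤ; +_; -[1+_])
open import Data.List using (List; []; _∷_; _++_; take; drop; reverse; map; upTo; length)
open import Data.Maybe using (just; nothing)
open import Data.List.Relation.Binary.Permutation.Propositional using (_↭_)
import Data.List as L

-- One-line notation: a permutation of [n] = {1,…,n} is the list π₁ π₂ ⋯ πₙ.
-- [1..n] as a list
oneToN : ℕ → List ℕ
oneToN n = map suc (upTo n)

InS : ℕ → List ℕ → Set
InS n π = π ↭ oneToN n

rev : List ℕ → List ℕ
rev = reverse

T : List ℕ → List ℕ
T []           = []
T π@(a ∷ _)    = drop a π ++ reverse (take a π)

-- inverse of T on S_n:  if σ = T(π) then a = π₁ = σₙ (last entry), and
-- π = reverse (last a entries of σ) ++ (first n−a entries of σ)
Tinv : List ℕ → List ℕ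
Tinv σ with L.last σ
... | nothing = σ
... | just a  = reverse (drop (length σ ∸ a) σ) ++ take (length σ ∸ a) σ

iter : (List ℕ → List ℕ) → ℕ → List ℕ → List ℕ
iter f zero    x = x
iter f (suc m) x = f (iter f m x)

Tpow : ℤ → List ℕ → List ℕ
Tpow (+ m)    = iter T m
Tpow -[1+ m ] = iter Tinv (suc m)

Tneg : ℤ → List ℕ → List ℕ
Tneg (+ zero)    = iter T zero
Tneg (+ (suc m)) = iter Tinv (suc m)
Tneg -[1+ m ]    = iter T (suc m)

{-# OPTIONS --safe #-}
module Submission where

open import Defs
open import Data.Nat using (ℕ; _≤_; zero; suc; _∸_)
open import Data.Integer using (ℤ; +_; -[1+_])
open import Data.List using (List; []; _∷_; _++_; _∷ʳ_; take; drop; reverse; length; last)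
open import Data.List.Properties
  using (take++drop≡id; reverse-++; reverse-involutive; length-reverse; length-drop; unfold-reverse)
open import Data.Maybe using (just)
open import Relation.Binary.PropositionalEquality
open ≡-Reasoning

-- T⁻¹ is the conjugate of T by reversal, T⁻¹ ∘ rev = rev ∘ T: the last entry of rev π is π₁,
-- and T⁻¹ cuts rev π at the mirror image of the place where T cuts π, so both sides put the
-- same two blocks together.  Iterating the conjugation gives the statement for every k.

module _ {a} {A : Set a} where

  take-length-++ : (xs ys : List A) → take (length xs) (xs ++ ys) ≡ xs
  take-length-++ []       ys = refl
  take-length-++ (x ∷ xs) ys = cong (x ∷_) (take-length-++ xs ys)

  drop-length-++ : (xs ys : List A) → drop (length xs) (xs ++ ys) ≡ ys
  drop-length-++ []       ys = refl
  drop-length-++ (x ∷ xs) ys = drop-length-++ xs ys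

  last-∷ʳ : (xs : List A) (x : A) → last (xs ∷ʳ x) ≡ just x
  last-∷ʳ []           x = refl
  last-∷ʳ (_ ∷ [])     x = refl
  last-∷ʳ (_ ∷ y ∷ xs) x = last-∷ʳ (y ∷ xs) x

  last-reverse-∷ : (x : A) (xs : List A) → last (reverse (x ∷ xs)) ≡ just x
  last-reverse-∷ x xs = trans (cong last (unfold-reverse x xs)) (last-∷ʳ (reverse xs) x)

  reverse-take++drop : (k : ℕ) (xs : List A) →
                       reverse xs ≡ reverse (drop k xs) ++ reverse (take k xs)
  reverse-take++drop k xs = begin
    reverse xs                              ≡⟨ cong reverse (take++drop≡id k xs) ⟨
    reverse (take k xs ++ drop k xs)        ≡⟨ reverse-++ (take k xs) (drop k xs) ⟩
    reverse (drop k xs) ++ reverse (take k xs) ∎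

  length-reverse-drop : (k : ℕ) (xs : List A) → length (reverse (drop k xs)) ≡ length xs ∸ k
  length-reverse-drop k xs = trans (length-reverse (drop k xs)) (length-drop k xs)

  take-reverse : (k : ℕ) (xs : List A) →
                 take (length xs ∸ k) (reverse xs) ≡ reverse (drop k xs)
  take-reverse k xs
    rewrite reverse-take++drop k xs | sym (length-reverse-drop k xs)
    = take-length-++ (reverse (drop k xs)) (reverse (take k xs))

  drop-reverse : (k : ℕ) (xs : List A) →
                 drop (length xs ∸ k) (reverse xs) ≡ reverse (take k xs)
  drop-reverse k xs
    rewrite reverse-take++drop k xs | sym (length-reverse-drop k xs)
    = drop-length-++ (reverse (drop k xs)) (reverse (take k xs))

iter-conjugate : (f g h : List ℕ → List ℕ) → (∀ x → g (h x) ≡ h (f x)) →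
                 ∀ m x → iter g m (h x) ≡ h (iter f m x)
iter-conjugate f g h g∘h≗h∘f zero    x = refl
iter-conjugate f g h g∘h≗h∘f (suc m) x =
  trans (cong g (iter-conjugate f g h g∘h≗h∘f m x)) (g∘h≗h∘f (iter f m x))

Tinv-last : (σ : List ℕ) {a : ℕ} → last σ ≡ just a →
            Tinv σ ≡ reverse (drop (length σ ∸ a) σ) ++ take (length σ ∸ a) σ
Tinv-last σ last≡a rewrite last≡a = refl

Tinv-reverse : (π : List ℕ) → Tinv (reverse π) ≡ reverse (T π)
Tinv-reverse []      = refl
Tinv-reverse π@(a ∷ r) = begin
  Tinv (reverse π)
    ≡⟨ Tinv-last (reverse π) (last-reverse-∷ a r) ⟩
  reverse (drop (length (reverse π) ∸ a) (reverse π)) ++ take (length (reverse π) ∸ a) (reverse π)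
    ≡⟨ cong (λ l → reverse (drop (l ∸ a) (reverse π)) ++ take (l ∸ a) (reverse π)) (length-reverse π) ⟩
  reverse (drop (length π ∸ a) (reverse π)) ++ take (length π ∸ a) (reverse π)
    ≡⟨ cong₂ (λ u v → reverse u ++ v) (drop-reverse a π) (take-reverse a π) ⟩
  reverse (reverse (take a π)) ++ reverse (drop a π)
    ≡⟨ reverse-++ (drop a π) (reverse (take a π)) ⟨
  reverse (T π) ∎

iter-Tinv-reverse : ∀ m π → iter Tinv m (reverse π) ≡ reverse (iter T m π)
iter-Tinv-reverse = iter-conjugate T Tinv reverse Tinv-reverse

iter-Tinv≡rev-iter-T-rev : ∀ m π → iter Tinv m π ≡ reverse (iter T m (reverse π))
iter-Tinv≡rev-iter-T-rev m π = begin
  iter Tinv m π                     ≡⟨ cong (iter Tinv m) (reverse-involutive π) ⟨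
  iter Tinv m (reverse (reverse π)) ≡⟨ iter-Tinv-reverse m (reverse π) ⟩
  reverse (iter T m (reverse π))    ∎

iter-T≡rev-iter-Tinv-rev : ∀ m π → iter T m π ≡ reverse (iter Tinv m (reverse π))
iter-T≡rev-iter-Tinv-rev m π = begin
  iter T m π                     ≡⟨ reverse-involutive (iter T m π) ⟨
  reverse (reverse (iter T m π)) ≡⟨ cong reverse (iter-Tinv-reverse m π) ⟨
  reverse (iter Tinv m (reverse π)) ∎

-- The identity holds for all lists with the concrete Tinv of Defs.
lemma2p6 : (n : ℕ) → 1 ≤ n → (π : List ℕ) → InS n π → (k : ℤ) →
             Tneg k π ≡ rev (Tpow k (rev π))
lemma2p6 _ _ π _ (+ zero)    = iter-T≡rev-iter-Tinv-rev zero π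
lemma2p6 _ _ π _ (+ (suc m)) = iter-Tinv≡rev-iter-T-rev (suc m) π
lemma2p6 _ _ π _ -[1+ m ]    = iter-T≡rev-iter-Tinv-rev (suc m) π
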